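{- For every odd prime $p$, the Laurent series $\Theta_p(t)\in\mathbb{F}_p(\!(t^{ -1})\!)$ is a quadratic irrational, i.e. it is not in $\mathbb{F}_p(t)$ and it is a root of a nonzero polynomial of degree $2$ with coefficients in $\mathbb{F}_p[t]$.
   Context: Let $p$ be an odd prime and $p_2=\frac{p-1}{2}$. Let $\phi_p$ map each letter $n\in\mathbb{F}_p$ to the length-$p$ word whose $i$-th letter ($0\le i\le p-1$) is $n\binom{p_2}{i/2}\bmod p$ for $i$ even and $0$ for $i$ odd, extended to words by concatenation. The $p$-Cantor sequence is $(c_i^{(p)})_{i\ge0}=\lim_{n\to\infty}\phi_p^n(1)$ and $\Theta_p(t)=t^{ -1}\sum_{i\ge0}c^{(p)}_it^{ -i}$. -}

module Defs where

open import Data.Nat using (ℕ; zero; suc; _+_; _*_; _∸_; _<ᵇ_; NonZero)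
open import Data.Nat.DivMod using (_/_; _%_)
open import Data.Nat.Divisibility using (_∣_)
open import Data.Nat.Combinatorics using (_C_)
open import Data.List using (List; []; _∷_; map; concatMap; upTo; length; reverse; foldr)
open import Data.List.Relation.Unary.Any using (Any)
open import Data.Bool using (if_then_else_)
open import Data.Product using (_×_; ∃₂; ∃-syntax)
open import Relation.Nullary using (¬_)
open import Relation.Binary.PropositionalEquality using (_≡_)

iter : {A : Set} → (A → A) → ℕ → A → A
iter f zero    a = a
iter f (suc n) a = f (iter f n a)

at : List ℕ → ℕ → ℕ
at []       _       = 0
at (x ∷ xs) zero    = x
at (x ∷ xs) (suc i) = at xs i

-- Elements of F_p are represented by natural numbers (read modulo p).
module _ (p : ℕ) .{{_ : NonZero p}} where

  p₂ : ℕ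
  p₂ = (p ∸ 1) / 2

  φ-letterAt : ℕ → ℕ → ℕ
  φ-letterAt n i with i % 2
  ... | zero  = (n * (p₂ C (i / 2))) % p
  ... | suc _ = 0

  φ-letter : ℕ → List ℕ
  φ-letter n = map (φ-letterAt n) (upTo p)

  φ : List ℕ → List ℕ
  φ = concatMap φ-letter

  -- p-Cantor sequence: c_i = i-th letter of φ_p^(i+1)(1); since p ≥ 2 the word
  -- φ_p^(i+1)(1) has length p^(i+1) > i and is a prefix of the limit word.
  cantor : ℕ → ℕ
  cantor i = at (iter φ (suc i) (1 ∷ [])) i

-- Laurent series in t⁻¹ over F_p:  mkLS m f  denotes  Σ_{i ≥ 0} f i · t^(m - i).
-- (Every element of F_p((t⁻¹)) has such a representation with m : ℕ.)
record LS : Set where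
  constructor mkLS
  field
    shift : ℕ
    coeff : ℕ → ℕ
open LS public

-- shift the coefficient sequence by k (same series, represented with shift + k)
pad : ℕ → (ℕ → ℕ) → ℕ → ℕ
pad k f i = if i <ᵇ k then 0 else f (i ∸ k)

sumTo : ℕ → (ℕ → ℕ) → ℕ
sumTo zero    g = g 0
sumTo (suc n) g = sumTo n g + g (suc n)

_⊕_ : LS → LS → LS
mkLS m f ⊕ mkLS n g = mkLS (m + n) (λ i → pad n f i + pad m g i)

_⊗_ : LS → LS → LS
mkLS m f ⊗ mkLS n g = mkLS (m + n) (λ i → sumTo i (λ j → f j * g (i ∸ j)))

infixl 6 _⊕_
infixl 7 _⊗_

zeroLS : LS
zeroLS = mkLS 0 (λ _ → 0)

-- polynomial a₀ + a₁ t + … + a_{d} t^d given by the list [a₀, …, a_d]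
poly : List ℕ → LS
poly l = mkLS (length l) (at (0 ∷ reverse l))

module _ (p : ℕ) .{{_ : NonZero p}} where

  infix 4 _≈ₚ_
  _≈ₚ_ : LS → LS → Set
  mkLS m f ≈ₚ mkLS n g = ∀ i → pad n f i % p ≡ pad m g i % p

  NonZeroPoly : List ℕ → Set
  NonZeroPoly l = Any (λ a → ¬ (p ∣ a)) l

  Θ : LS
  Θ = mkLS 0 coeffΘ
    where
    coeffΘ : ℕ → ℕ
    coeffΘ zero    = 0
    coeffΘ (suc i) = cantor p i

  IsRational : LS → Set
  IsRational x = ∃₂ λ (P Q : List ℕ) → NonZeroPoly Q × (poly Q ⊗ x ≈ₚ poly P)

  IsQuadraticRoot : LS → Set
  IsQuadraticRoot x = ∃[ A ] ∃[ B ] ∃[ C ]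
    (NonZeroPoly A × (poly A ⊗ x ⊗ x ⊕ poly B ⊗ x ⊕ poly C ≈ₚ zeroLS))

  IsQuadraticIrrational : LS → Set
  IsQuadraticIrrational x = (¬ IsRational x) × IsQuadraticRoot x

-- Write x = t⁻¹ and c(x) = Σ cᵢ xⁱ, so that Θ = x c.  Reading the letter rule of φ_p on
-- base-p digits gives c_{r+kp} ≡ E_r c_k, i.e. c(x) ≡ E(x) c(xᵖ) (mod p) with E = (1 + x²)^p₂.
-- Hence G = (1 + x²) c² satisfies G(x) ≡ (1 + x²)ᵖ c(xᵖ)² ≡ G(xᵖ) by Frobenius, which forces
-- G ≡ G(0) = 1; this is (1 + t²) Θ² = 1.  Θ is not rational because c_{pᵏ-1} = 1 is followed by
-- pᵏ zeros: past such a gap a coefficient of Q Θ isolates the last nonzero coefficient of Q, so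
-- Q Θ is never a polynomial.

module Submission where

open import Defs
open import Data.Nat
open import Data.Nat.Properties
open import Data.Nat.Induction using (<-rec)
open import Data.Nat.DivMod
open import Data.Nat.Divisibility
open import Data.Nat.Combinatorics using (_C_; nCk+nC[k+1]≡[n+1]C[k+1]; nC1≡n; nCn≡1; k>n⇒nCk≡0)
open import Data.Nat.Primality using (Prime; euclidsLemma; prime⇒nonTrivial; prime⇒irreducible)
open import Data.Nat.Solver using (module +-*-Solver)
open import Data.Sum using (inj₁; inj₂)
open import Data.Product using (∃; _×_; _,_)
open import Data.Bool using (true; false)
open import Data.List.Relation.Unary.Any using (Any; here; there; any?)
open import Relation.Nullary.Decidable using (decidable-stable; ¬?)
open import Data.List using (List; []; _∷_; _++_; length; map; applyUpTo; upTo; concat; reverse)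
open import Data.List.Relation.Unary.Any.Properties using (reverse⁺)
open import Data.List.Properties using (length-++; length-map; length-upTo; map-++; concat-++; map-applyUpTo; length-reverse)
open import Function using (_∘_; id)
open import Data.Empty using (⊥-elim)
open import Relation.Nullary using (¬_; yes; no)
open import Relation.Binary.Definitions using (tri<; tri≈; tri>)
open import Relation.Binary.PropositionalEquality
open import Algebra.Properties.CommutativeSemigroup +-commutativeSemigroup using (interchange)
open ≡-Reasoning
open +-*-Solver using (solve; _:=_; _:+_; _:*_; con)

-- Finite sums

Series : Set
Series = ℕ → ℕ

sumTo-cong : ∀ n {f g : Series} → (∀ j → j ≤ n → f j ≡ g j) → sumTo n f ≡ sumTo n g
sumTo-cong zero    f≡g = f≡g 0 z≤n
sumTo-cong (suc n) f≡g =
  cong₂ _+_ (sumTo-cong n (λ j j≤n → f≡g j (m≤n⇒m≤1+n j≤n))) (f≡g (suc n) ≤-refl)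

sumTo-+ : ∀ n (f g : Series) → sumTo n (λ j → f j + g j) ≡ sumTo n f + sumTo n g
sumTo-+ zero    f g = refl
sumTo-+ (suc n) f g = begin
  sumTo n (λ j → f j + g j) + (f (suc n) + g (suc n))
    ≡⟨ cong (_+ (f (suc n) + g (suc n))) (sumTo-+ n f g) ⟩
  sumTo n f + sumTo n g + (f (suc n) + g (suc n))
    ≡⟨ interchange (sumTo n f) (sumTo n g) (f (suc n)) (g (suc n)) ⟩
  sumTo n f + f (suc n) + (sumTo n g + g (suc n)) ∎

sumTo-*ˡ : ∀ n a (f : Series) → sumTo n (λ j → a * f j) ≡ a * sumTo n f
sumTo-*ˡ zero    a f = refl
sumTo-*ˡ (suc n) a f =
  trans (cong (_+ a * f (suc n)) (sumTo-*ˡ n a f)) (sym (*-distribˡ-+ a (sumTo n f) (f (suc n))))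

sumTo-*ʳ : ∀ n a (f : Series) → sumTo n (λ j → f j * a) ≡ sumTo n f * a
sumTo-*ʳ zero    a f = refl
sumTo-*ʳ (suc n) a f =
  trans (cong (_+ f (suc n) * a) (sumTo-*ʳ n a f)) (sym (*-distribʳ-+ a (sumTo n f) (f (suc n))))

sumTo-suc : ∀ n (f : Series) → sumTo (suc n) f ≡ f 0 + sumTo n (λ j → f (suc j))
sumTo-suc zero    f = refl
sumTo-suc (suc n) f = trans (cong (_+ f (2 + n)) (sumTo-suc n f)) (+-assoc (f 0) _ _)

sumTo-split : ∀ m n (f : Series) →
              sumTo (m + suc n) f ≡ sumTo m f + sumTo n (λ j → f (m + suc j))
sumTo-split m zero    f rewrite +-comm m 1 = refl
sumTo-split m (suc n) f rewrite +-suc m (suc n) =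
  trans (cong (_+ f (suc (m + suc n))) (sumTo-split m n f)) (+-assoc (sumTo m f) _ _)

sumTo-reverse : ∀ n (f : Series) → sumTo n f ≡ sumTo n (λ j → f (n ∸ j))
sumTo-reverse zero    f = refl
sumTo-reverse (suc n) f = begin
  sumTo n f + f (suc n)                     ≡⟨ cong (_+ f (suc n)) (sumTo-reverse n f) ⟩
  sumTo n (λ j → f (n ∸ j)) + f (suc n)     ≡⟨ +-comm _ (f (suc n)) ⟩
  f (suc n) + sumTo n (λ j → f (n ∸ j))     ≡⟨ sym (sumTo-suc n (λ j → f (suc n ∸ j))) ⟩
  sumTo (suc n) (λ j → f (suc n ∸ j))       ∎

sumTo-zero : ∀ n (f : Series) → (∀ j → j ≤ n → f j ≡ 0) → sumTo n f ≡ 0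
sumTo-zero zero    f f≡0 = f≡0 0 z≤n
sumTo-zero (suc n) f f≡0 =
  cong₂ _+_ (sumTo-zero n f (λ j j≤n → f≡0 j (m≤n⇒m≤1+n j≤n))) (f≡0 (suc n) ≤-refl)

sumTo-single : ∀ n (f : Series) i → i ≤ n → (∀ j → j ≤ n → j ≢ i → f j ≡ 0) → sumTo n f ≡ f i
sumTo-single zero    f .zero z≤n _ = refl
sumTo-single (suc n) f i i≤1+n others with i ≟ suc n
... | yes refl = cong (_+ f (suc n))
  (sumTo-zero n f (λ j j≤n → others j (m≤n⇒m≤1+n j≤n) (λ { refl → 1+n≰n j≤n })))
... | no i≢1+n = trans (cong₂ _+_
  (sumTo-single n f i (≤-pred (≤∧≢⇒< i≤1+n i≢1+n)) (λ j j≤n → others j (m≤n⇒m≤1+n j≤n)))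
  (others (suc n) ≤-refl (λ 1+n≡i → i≢1+n (sym 1+n≡i)))) (+-identityʳ (f i))

sumTo-triangle : ∀ n (a : ℕ → ℕ → ℕ) →
  sumTo n (λ i → sumTo i (a i)) ≡ sumTo n (λ j → sumTo (n ∸ j) (λ k → a (j + k) j))
sumTo-triangle zero    a = refl
sumTo-triangle (suc n) a = begin
  sumTo n (λ i → sumTo i (a i)) + sumTo (suc n) (a (suc n))
    ≡⟨ cong (_+ sumTo (suc n) (a (suc n))) (sumTo-triangle n a) ⟩
  sumTo n (λ j → sumTo (n ∸ j) (λ k → a (j + k) j)) + sumTo (suc n) (a (suc n))
    ≡⟨ +-assoc _ (sumTo n (a (suc n))) (a (suc n) (suc n)) ⟨
  sumTo n (λ j → sumTo (n ∸ j) (λ k → a (j + k) j)) + sumTo n (a (suc n)) + a (suc n) (suc n)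
    ≡⟨ cong (_+ a (suc n) (suc n)) (sym (sumTo-+ n _ (a (suc n)))) ⟩
  sumTo n (λ j → sumTo (n ∸ j) (λ k → a (j + k) j) + a (suc n) j) + a (suc n) (suc n)
    ≡⟨ cong₂ _+_ (sumTo-cong n column) (cong (λ m → a m (suc n)) (sym (+-identityʳ (suc n)))) ⟩
  sumTo n (λ j → sumTo (suc n ∸ j) (λ k → a (j + k) j)) + a (suc n + 0) (suc n)
    ≡⟨ cong (λ m → sumTo n (λ j → sumTo (suc n ∸ j) (λ k → a (j + k) j)) + sumTo m (λ k → a (suc n + k) (suc n)))
            (sym (n∸n≡0 n)) ⟩
  sumTo (suc n) (λ j → sumTo (suc n ∸ j) (λ k → a (j + k) j)) ∎
  where
  column : ∀ j → j ≤ n →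
    sumTo (n ∸ j) (λ k → a (j + k) j) + a (suc n) j ≡ sumTo (suc n ∸ j) (λ k → a (j + k) j)
  column j j≤n rewrite +-∸-assoc 1 j≤n =
    cong (λ m → sumTo (n ∸ j) (λ k → a (j + k) j) + a m j) (sym (trans (+-suc j (n ∸ j)) (cong suc (m+[n∸m]≡n j≤n))))

sumTo-multiples : ∀ q .{{_ : NonZero q}} m (h : Series) → (∀ j → ¬ q ∣ j → h j ≡ 0) →
                  sumTo (m * q) h ≡ sumTo m (λ i → h (i * q))
sumTo-multiples q         zero    h _       = refl
sumTo-multiples q@(suc q-1) (suc m) h support = begin
  sumTo (q + m * q) h                    ≡⟨ cong (λ k → sumTo k h) (+-comm q (m * q)) ⟩
  sumTo (m * q + suc q-1) h              ≡⟨ sumTo-split (m * q) q-1 h ⟩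
  sumTo (m * q) h + sumTo q-1 (λ t → h (m * q + suc t))
    ≡⟨ cong₂ _+_ (sumTo-multiples q m h support) (sumTo-single q-1 _ q-1 ≤-refl inside) ⟩
  sumTo m (λ i → h (i * q)) + h (m * q + q) ≡⟨ cong (λ k → sumTo m (λ i → h (i * q)) + h k) (+-comm (m * q) q) ⟩
  sumTo m (λ i → h (i * q)) + h (q + m * q) ∎
  where
  inside : ∀ t → t ≤ q-1 → t ≢ q-1 → h (m * q + suc t) ≡ 0
  inside t t≤ t≢ = support _ (λ q∣ → <⇒≱ (s≤s (≤∧≢⇒< t≤ t≢)) (∣⇒≤ (∣m+n∣m⇒∣n q∣ (n∣m*n m))))

-- Power series with coefficients in ℕ

infixl 7 _⋆_
_⋆_ : Series → Series → Series
(f ⋆ g) n = sumTo n (λ j → f j * g (n ∸ j))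

⋆-cong : ∀ {f f′ g g′} → f ≗ f′ → g ≗ g′ → f ⋆ g ≗ f′ ⋆ g′
⋆-cong f≗f′ g≗g′ n = sumTo-cong n (λ j _ → cong₂ _*_ (f≗f′ j) (g≗g′ (n ∸ j)))

⋆-congˡ : ∀ f {g g′} → g ≗ g′ → f ⋆ g ≗ f ⋆ g′
⋆-congˡ f = ⋆-cong {f} (λ _ → refl)

⋆-congʳ : ∀ {f f′} g → f ≗ f′ → f ⋆ g ≗ f′ ⋆ g
⋆-congʳ g f≗f′ = ⋆-cong {g = g} f≗f′ (λ _ → refl)

⋆-comm : ∀ f g → f ⋆ g ≗ g ⋆ f
⋆-comm f g n = begin
  sumTo n (λ j → f j * g (n ∸ j))               ≡⟨ sumTo-reverse n _ ⟩
  sumTo n (λ j → f (n ∸ j) * g (n ∸ (n ∸ j)))   ≡⟨ sumTo-cong n swap ⟩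
  sumTo n (λ j → g j * f (n ∸ j))               ∎
  where
  swap : ∀ j → j ≤ n → f (n ∸ j) * g (n ∸ (n ∸ j)) ≡ g j * f (n ∸ j)
  swap j j≤n rewrite m∸[m∸n]≡n j≤n = *-comm (f (n ∸ j)) (g j)

⋆-assoc : ∀ f g h → (f ⋆ g) ⋆ h ≗ f ⋆ (g ⋆ h)
⋆-assoc f g h n = begin
  sumTo n (λ i → sumTo i (λ j → f j * g (i ∸ j)) * h (n ∸ i))
    ≡⟨ sumTo-cong n (λ i _ → sym (sumTo-*ʳ i (h (n ∸ i)) _)) ⟩
  sumTo n (λ i → sumTo i (λ j → f j * g (i ∸ j) * h (n ∸ i)))
    ≡⟨ sumTo-triangle n (λ i j → f j * g (i ∸ j) * h (n ∸ i)) ⟩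
  sumTo n (λ j → sumTo (n ∸ j) (λ k → f j * g (j + k ∸ j) * h (n ∸ (j + k))))
    ≡⟨ sumTo-cong n (λ j _ → trans (sumTo-cong (n ∸ j) (λ k _ → reassoc j k)) (sumTo-*ˡ (n ∸ j) (f j) _)) ⟩
  sumTo n (λ j → f j * sumTo (n ∸ j) (λ k → g k * h (n ∸ j ∸ k))) ∎
  where
  reassoc : ∀ j k → f j * g (j + k ∸ j) * h (n ∸ (j + k)) ≡ f j * (g k * h (n ∸ j ∸ k))
  reassoc j k rewrite m+n∸m≡n j k | ∸-+-assoc n j k = *-assoc (f j) (g k) _

⋆-interchange : ∀ a b c d → (a ⋆ b) ⋆ (c ⋆ d) ≗ (a ⋆ c) ⋆ (b ⋆ d)
⋆-interchange a b c d n = begin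
  ((a ⋆ b) ⋆ (c ⋆ d)) n   ≡⟨ ⋆-assoc a b (c ⋆ d) n ⟩
  (a ⋆ (b ⋆ (c ⋆ d))) n   ≡⟨ ⋆-congˡ a middle n ⟩
  (a ⋆ (c ⋆ (b ⋆ d))) n   ≡⟨ ⋆-assoc a c (b ⋆ d) n ⟨
  ((a ⋆ c) ⋆ (b ⋆ d)) n   ∎
  where
  middle : b ⋆ (c ⋆ d) ≗ c ⋆ (b ⋆ d)
  middle m = begin
    (b ⋆ (c ⋆ d)) m   ≡⟨ ⋆-assoc b c d m ⟨
    ((b ⋆ c) ⋆ d) m   ≡⟨ ⋆-congʳ d (⋆-comm b c) m ⟩
    ((c ⋆ b) ⋆ d) m   ≡⟨ ⋆-assoc c b d m ⟩
    (c ⋆ (b ⋆ d)) m   ∎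

timesX : Series → Series
timesX f zero    = 0
timesX f (suc n) = f n

timesX-cong : ∀ {f g} → f ≗ g → timesX f ≗ timesX g
timesX-cong f≗g zero    = refl
timesX-cong f≗g (suc n) = f≗g n

⋆-timesXˡ : ∀ f g → timesX f ⋆ g ≗ timesX (f ⋆ g)
⋆-timesXˡ f g zero    = refl
⋆-timesXˡ f g (suc n) = sumTo-suc n _

⋆-timesXʳ : ∀ f g → f ⋆ timesX g ≗ timesX (f ⋆ g)
⋆-timesXʳ f g n = begin
  (f ⋆ timesX g) n       ≡⟨ ⋆-comm f (timesX g) n ⟩
  (timesX g ⋆ f) n       ≡⟨ ⋆-timesXˡ g f n ⟩
  timesX (g ⋆ f) n       ≡⟨ timesX-cong (⋆-comm g f) n ⟩
  timesX (f ⋆ g) n       ∎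

⋆-timesX : ∀ f g → timesX f ⋆ timesX g ≗ timesX (timesX (f ⋆ g))
⋆-timesX f g n = trans (⋆-timesXˡ f (timesX g) n) (timesX-cong (⋆-timesXʳ f g) n)

binomial : ℕ → Series
binomial n k = n C k

binomial0⋆ : ∀ u → binomial 0 ⋆ u ≗ u
binomial0⋆ u n = trans (sumTo-single n _ 0 z≤n others) (+-identityʳ (u n))
  where
  others : ∀ j → j ≤ n → j ≢ 0 → (0 C j) * u (n ∸ j) ≡ 0
  others zero    _ 0≢0 = ⊥-elim (0≢0 refl)
  others (suc j) _ _   = refl

binomial1⋆ : ∀ u → binomial 1 ⋆ u ≗ λ n → u n + timesX u n
binomial1⋆ u zero    = refl
binomial1⋆ u (suc n) = begin
  (binomial 1 ⋆ u) (suc n)                              ≡⟨ sumTo-suc n _ ⟩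
  u (suc n) + 0 + sumTo n (λ j → (1 C suc j) * u (n ∸ j)) ≡⟨ cong₂ _+_ (+-identityʳ (u (suc n))) (sumTo-single n _ 0 z≤n others) ⟩
  u (suc n) + (u n + 0)                                 ≡⟨ cong (u (suc n) +_) (+-identityʳ (u n)) ⟩
  u (suc n) + u n                                       ∎
  where
  others : ∀ j → j ≤ n → j ≢ 0 → (1 C suc j) * u (n ∸ j) ≡ 0
  others zero    _ 0≢0 = ⊥-elim (0≢0 refl)
  others (suc j) _ _   = refl

binomial-suc : ∀ n → binomial (suc n) ≗ binomial 1 ⋆ binomial n
binomial-suc n zero    = refl
binomial-suc n (suc k) = begin
  suc n C suc k           ≡⟨ nCk+nC[k+1]≡[n+1]C[k+1] n k ⟨
  n C k + n C suc k       ≡⟨ +-comm (n C k) (n C suc k) ⟩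
  n C suc k + n C k       ≡⟨ binomial1⋆ (binomial n) (suc k) ⟨
  (binomial 1 ⋆ binomial n) (suc k) ∎

vandermonde : ∀ a b → binomial a ⋆ binomial b ≗ binomial (a + b)
vandermonde zero    b = binomial0⋆ (binomial b)
vandermonde (suc a) b n = begin
  (binomial (suc a) ⋆ binomial b) n              ≡⟨ ⋆-congʳ (binomial b) (binomial-suc a) n ⟩
  ((binomial 1 ⋆ binomial a) ⋆ binomial b) n     ≡⟨ ⋆-assoc (binomial 1) (binomial a) (binomial b) n ⟩
  (binomial 1 ⋆ (binomial a ⋆ binomial b)) n     ≡⟨ ⋆-congˡ (binomial 1) (vandermonde a b) n ⟩
  (binomial 1 ⋆ binomial (a + b)) n              ≡⟨ binomial-suc (a + b) n ⟨
  binomial (suc a + b) n                         ∎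

-- Dilation f(x) ↦ f(x^q)

dilate : (q : ℕ) .{{_ : NonZero q}} → Series → Series
dilate q f n with n % q
... | zero  = f (n / q)
... | suc _ = 0

module _ (q : ℕ) .{{q≢0 : NonZero q}} where

  dilate-* : ∀ f m → dilate q f (m * q) ≡ f m
  dilate-* f m rewrite m*n%n≡0 m q ⦃ q≢0 ⦄ | m*n/n≡m m q ⦃ q≢0 ⦄ = refl

  dilate-cong : ∀ {f g} → f ≗ g → dilate q f ≗ dilate q g
  dilate-cong f≗g n with n % q
  ... | zero  = f≗g (n / q)
  ... | suc _ = refl

  dilate-∤ : ∀ f {n} → ¬ q ∣ n → dilate q f n ≡ 0
  dilate-∤ f {n} q∤n with n % q in n%q≡r
  ... | zero  = ⊥-elim (q∤n (m%n≡0⇒n∣m n q n%q≡r))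
  ... | suc _ = refl

  dilate-⋆ : ∀ f g → dilate q f ⋆ dilate q g ≗ dilate q (f ⋆ g)
  dilate-⋆ f g n with q ∣? n
  ... | no q∤n = trans (sumTo-zero n _ vanish) (sym (dilate-∤ (f ⋆ g) q∤n))
    where
    vanish : ∀ j → j ≤ n → dilate q f j * dilate q g (n ∸ j) ≡ 0
    vanish j j≤n with q ∣? j | q ∣? (n ∸ j)
    ... | no q∤j | _       = cong (_* dilate q g (n ∸ j)) (dilate-∤ f q∤j)
    ... | yes _  | no q∤k  = trans (cong (dilate q f j *_) (dilate-∤ g q∤k)) (*-zeroʳ (dilate q f j))
    ... | yes q∣j | yes q∣k =
      ⊥-elim (q∤n (subst (q ∣_) (m+[n∸m]≡n j≤n) (∣m∣n⇒∣m+n q∣j q∣k)))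
  ... | yes (divides-refl m) = begin
    sumTo (m * q) (λ j → dilate q f j * dilate q g (m * q ∸ j))
      ≡⟨ sumTo-multiples q m _ (λ j q∤j → cong (_* dilate q g (m * q ∸ j)) (dilate-∤ f q∤j)) ⟩
    sumTo m (λ i → dilate q f (i * q) * dilate q g (m * q ∸ i * q))
      ≡⟨ sumTo-cong m (λ i _ → cong₂ _*_ (dilate-* f i) (dilate-diff i)) ⟩
    (f ⋆ g) m
      ≡⟨ dilate-* (f ⋆ g) m ⟨
    dilate q (f ⋆ g) (m * q) ∎
    where
    dilate-diff : ∀ i → dilate q g (m * q ∸ i * q) ≡ g (m ∸ i)
    dilate-diff i = trans (cong (dilate q g) (sym (*-distribʳ-∸ q m i))) (dilate-* g (m ∸ i))

  ⋆-dilate-digit : ∀ e f → (∀ j → q ≤ j → e j ≡ 0) → ∀ k {r} → r < q →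
                   (e ⋆ dilate q f) (r + k * q) ≡ e r * f k
  ⋆-dilate-digit e f deg<q k {r} r<q = begin
    (e ⋆ dilate q f) n                ≡⟨ sumTo-single n _ r (m≤m+n r (k * q)) others ⟩
    e r * dilate q f (r + k * q ∸ r)  ≡⟨ cong (λ i → e r * dilate q f i) (m+n∸m≡n r (k * q)) ⟩
    e r * dilate q f (k * q)          ≡⟨ cong (e r *_) (dilate-* f k) ⟩
    e r * f k                         ∎
    where
    n = r + k * q
    others : ∀ j → j ≤ n → j ≢ r → e j * dilate q f (n ∸ j) ≡ 0
    others j j≤n j≢r with q ≤? j
    ... | yes q≤j = cong (_* dilate q f (n ∸ j)) (deg<q j q≤j)
    ... | no  q≰j = trans (cong (e j *_) (dilate-∤ f q∤n∸j)) (*-zeroʳ (e j))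
      where
      q∤n∸j : ¬ q ∣ n ∸ j
      q∤n∸j (divides c n∸j≡c*q) = j≢r (begin
        j                   ≡⟨ m<n⇒m%n≡m (≰⇒> q≰j) ⟨
        j % q               ≡⟨ [m+kn]%n≡m%n j c q ⟨
        (j + c * q) % q     ≡⟨ cong (λ i → (j + i) % q) n∸j≡c*q ⟨
        (j + (n ∸ j)) % q   ≡⟨ cong (_% q) (m+[n∸m]≡n j≤n) ⟩
        (r + k * q) % q     ≡⟨ [m+kn]%n≡m%n r k q ⟩
        r % q               ≡⟨ m<n⇒m%n≡m r<q ⟩
        r                   ∎)

dilate-dilate-* : ∀ a b .{{_ : NonZero a}} .{{_ : NonZero b}} f j →
                  dilate a (dilate b f) (j * (b * a)) ≡ f j
dilate-dilate-* a b f j =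
  trans (cong (dilate a (dilate b f)) (sym (*-assoc j b a))) (trans (dilate-* a _ (j * b)) (dilate-* b f j))

dilate-dilate-∤ : ∀ a b .{{_ : NonZero a}} .{{_ : NonZero b}} f {n} →
                  ¬ b * a ∣ n → dilate a (dilate b f) n ≡ 0
dilate-dilate-∤ a b f {n} ba∤n with a ∣? n
... | no a∤n = dilate-∤ a _ a∤n
... | yes (divides-refl k) with b ∣? k
...   | no b∤k = trans (dilate-* a _ k) (dilate-∤ b f b∤k)
...   | yes (divides-refl j) = ⊥-elim (ba∤n (divides j (*-assoc j b a)))

dilate-comm : ∀ a b .{{_ : NonZero a}} .{{_ : NonZero b}} f → dilate a (dilate b f) ≗ dilate b (dilate a f)
dilate-comm a b f n with b * a ∣? n
... | yes (divides-refl j) = begin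
  dilate a (dilate b f) (j * (b * a))  ≡⟨ dilate-dilate-* a b f j ⟩
  f j                                  ≡⟨ dilate-dilate-* b a f j ⟨
  dilate b (dilate a f) (j * (a * b))  ≡⟨ cong (λ k → dilate b (dilate a f) (j * k)) (*-comm a b) ⟩
  dilate b (dilate a f) (j * (b * a))  ∎
... | no ba∤n =
  trans (dilate-dilate-∤ a b f ba∤n) (sym (dilate-dilate-∤ b a f (λ ab∣n → ba∤n (subst (_∣ n) (*-comm a b) ab∣n))))

[1+x²]^_ : ℕ → Series
[1+x²]^ n = dilate 2 (binomial n)

[1+x²]^1≗ : [1+x²]^ 1 ≗ at (1 ∷ 0 ∷ 1 ∷ [])
[1+x²]^1≗ 0 = refl
[1+x²]^1≗ 1 = refl
[1+x²]^1≗ 2 = refl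
[1+x²]^1≗ (suc (suc (suc n))) with 2 ∣? (3 + n)
... | no 2∤ = dilate-∤ 2 (binomial 1) 2∤
... | yes (divides (suc (suc j)) 3+n≡j*2) = trans (cong ([1+x²]^ 1) 3+n≡j*2) (dilate-* 2 (binomial 1) (2 + j))

[1+x²]^-+ : ∀ a b → [1+x²]^ a ⋆ [1+x²]^ b ≗ [1+x²]^ (a + b)
[1+x²]^-+ a b n = trans (dilate-⋆ 2 (binomial a) (binomial b) n) (dilate-cong 2 (vandermonde a b) n)

-- Congruence of series modulo m

module Congruence (m : ℕ) .{{m≢0 : NonZero m}} where

  infix 4 _≈_
  _≈_ : Series → Series → Set
  f ≈ g = ∀ n → f n % m ≡ g n % m

  0%m≡0 : 0 % m ≡ 0
  0%m≡0 = m*n%n≡0 0 m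

  +-cong-mod : ∀ {a a′ b b′} → a % m ≡ a′ % m → b % m ≡ b′ % m → (a + b) % m ≡ (a′ + b′) % m
  +-cong-mod {a} {a′} {b} {b′} a≡a′ b≡b′ = begin
    (a + b) % m                 ≡⟨ %-distribˡ-+ a b m ⟩
    (a % m + b % m) % m         ≡⟨ cong₂ (λ x y → (x + y) % m) a≡a′ b≡b′ ⟩
    (a′ % m + b′ % m) % m       ≡⟨ %-distribˡ-+ a′ b′ m ⟨
    (a′ + b′) % m               ∎

  *-cong-mod : ∀ {a a′ b b′} → a % m ≡ a′ % m → b % m ≡ b′ % m → (a * b) % m ≡ (a′ * b′) % m
  *-cong-mod {a} {a′} {b} {b′} a≡a′ b≡b′ = begin
    (a * b) % m                 ≡⟨ %-distribˡ-* a b m ⟩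
    (a % m * (b % m)) % m       ≡⟨ cong₂ (λ x y → (x * y) % m) a≡a′ b≡b′ ⟩
    (a′ % m * (b′ % m)) % m     ≡⟨ %-distribˡ-* a′ b′ m ⟨
    (a′ * b′) % m               ∎

  sumTo-cong-mod : ∀ n {f g : Series} → (∀ j → j ≤ n → f j % m ≡ g j % m) → sumTo n f % m ≡ sumTo n g % m
  sumTo-cong-mod zero    f≡g = f≡g 0 z≤n
  sumTo-cong-mod (suc n) f≡g =
    +-cong-mod (sumTo-cong-mod n (λ j j≤n → f≡g j (m≤n⇒m≤1+n j≤n))) (f≡g (suc n) ≤-refl)

  ⋆-cong-≈ : ∀ {f f′ g g′} → f ≈ f′ → g ≈ g′ → f ⋆ g ≈ f′ ⋆ g′
  ⋆-cong-≈ f≈f′ g≈g′ n = sumTo-cong-mod n (λ j _ → *-cong-mod (f≈f′ j) (g≈g′ (n ∸ j)))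

  sumTo-single-mod : ∀ n (f : Series) i → i ≤ n → (∀ j → j ≤ n → j ≢ i → f j % m ≡ 0) →
                     sumTo n f % m ≡ f i % m
  sumTo-single-mod n f i i≤n others = begin
    sumTo n f % m                   ≡⟨ sumTo-cong-mod n (λ j _ → sym (m%n%n≡m%n (f j) m)) ⟩
    sumTo n (λ j → f j % m) % m     ≡⟨ cong (_% m) (sumTo-single n _ i i≤n others) ⟩
    f i % m % m                     ≡⟨ m%n%n≡m%n (f i) m ⟩
    f i % m                         ∎

  ⋆-last-term : ∀ a θ j₀ n → (∀ j → j₀ < j → m ∣ a j) → θ n ≡ 1 →
                (∀ i → n < i → i ≤ n + j₀ → θ i ≡ 0) → (a ⋆ θ) (n + j₀) % m ≡ a j₀ % m
  ⋆-last-term a θ j₀ n a-above θn≡1 θ-gap = begin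
    (a ⋆ θ) (n + j₀) % m                   ≡⟨ sumTo-single-mod (n + j₀) _ j₀ (m≤n+m j₀ n) others ⟩
    (a j₀ * θ (n + j₀ ∸ j₀)) % m           ≡⟨ cong (λ i → (a j₀ * θ i) % m) (m+n∸n≡m n j₀) ⟩
    (a j₀ * θ n) % m                       ≡⟨ cong (λ t → (a j₀ * t) % m) θn≡1 ⟩
    (a j₀ * 1) % m                         ≡⟨ cong (_% m) (*-identityʳ (a j₀)) ⟩
    a j₀ % m                               ∎
    where
    others : ∀ j → j ≤ n + j₀ → j ≢ j₀ → (a j * θ (n + j₀ ∸ j)) % m ≡ 0
    others j j≤ j≢j₀ with <-cmp j j₀
    ... | tri≈ _ j≡j₀ _ = ⊥-elim (j≢j₀ j≡j₀)
    ... | tri> _ _ j₀<j = n∣m⇒m%n≡0 _ m (∣m⇒∣m*n (θ (n + j₀ ∸ j)) (a-above j j₀<j))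
    ... | tri< j<j₀ _ _ = begin
      (a j * θ (n + j₀ ∸ j)) % m   ≡⟨ cong (λ t → (a j * t) % m) (θ-gap (n + j₀ ∸ j) n<i i≤) ⟩
      (a j * 0) % m                ≡⟨ cong (_% m) (*-zeroʳ (a j)) ⟩
      0 % m                        ≡⟨ 0%m≡0 ⟩
      0                            ∎
      where
      n<i : n < n + j₀ ∸ j
      n<i = subst (n <_) (sym (+-∸-assoc n (<⇒≤ j<j₀))) (m<m+n n (m<n⇒0<n∸m j<j₀))
      i≤ : n + j₀ ∸ j ≤ n + j₀
      i≤ = m∸n≤m (n + j₀) j

  dilate-cong-≈ : ∀ q .{{_ : NonZero q}} {f g} → f ≈ g → dilate q f ≈ dilate q g
  dilate-cong-≈ q f≈g n with n % q
  ... | zero  = f≈g (n / q)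
  ... | suc _ = refl

  dilate-invariant⇒constant : ∀ q .{{_ : NonZero q}} → 1 < q → ∀ f → f ≈ dilate q f →
                              ∀ n → 0 < n → f n % m ≡ 0
  dilate-invariant⇒constant q 1<q f f≈f[xᵠ] = <-rec (λ n → 0 < n → f n % m ≡ 0) step
    where
    step : ∀ n → (∀ {k} → k < n → 0 < k → f k % m ≡ 0) → 0 < n → f n % m ≡ 0
    step n rec 0<n with q ∣? n
    ... | no q∤n = trans (f≈f[xᵠ] n) (trans (cong (_% m) (dilate-∤ q f q∤n)) 0%m≡0)
    ... | yes (divides-refl k@(suc _)) =
      trans (f≈f[xᵠ] (k * q)) (trans (cong (_% m) (dilate-* q f k)) (rec (m<m*n k q 1<q) z<s))

absorption : ∀ n k → suc k * (suc n C suc k) ≡ suc n * (n C k)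
absorption zero    zero    = refl
absorption zero    (suc k) = *-zeroʳ (2 + k)
absorption (suc n) zero    = trans (+-identityʳ _) (trans (nC1≡n (2 + n)) (sym (*-identityʳ (2 + n))))
absorption (suc n) (suc k) = begin
  (2 + k) * ((2 + n) C (2 + k))             ≡⟨ cong ((2 + k) *_) (nCk+nC[k+1]≡[n+1]C[k+1] (suc n) (suc k)) ⟨
  (2 + k) * (a + b)                         ≡⟨ solve 3 (λ K A B → (con 2 :+ K) :* (A :+ B) := A :+ (con 1 :+ K) :* A :+ (con 2 :+ K) :* B) refl k a b ⟩
  a + (1 + k) * a + (2 + k) * b             ≡⟨ cong₂ (λ x y → a + x + y) (absorption n k) (absorption n (suc k)) ⟩
  a + (1 + n) * (n C k) + (1 + n) * (n C suc k)
    ≡⟨ +-assoc a _ _ ⟩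
  a + ((1 + n) * (n C k) + (1 + n) * (n C suc k))
    ≡⟨ cong (a +_) (*-distribˡ-+ (1 + n) (n C k) (n C suc k)) ⟨
  a + (1 + n) * (n C k + n C suc k)         ≡⟨ cong (λ x → a + (1 + n) * x) (nCk+nC[k+1]≡[n+1]C[k+1] n k) ⟩
  (2 + n) * a                               ∎
  where
  a = suc n C suc k
  b = suc n C (2 + k)

prime∣binomial : ∀ {p k} → Prime p → ¬ p ∣ k → p ∣ p C k
prime∣binomial {p}     {zero}  _ p∤0 = ⊥-elim (p∤0 (p ∣0))
prime∣binomial {zero}  {suc k} _ _   = ∣-refl
prime∣binomial {suc n} {suc k} p-prime p∤k with <-cmp (suc k) (suc n)
... | tri≈ _ refl _ = ⊥-elim (p∤k ∣-refl)
... | tri> _ _ k>p  = subst (suc n ∣_) (sym (k>n⇒nCk≡0 k>p)) (suc n ∣0)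
... | tri< k<p _ _
  with euclidsLemma (suc k) (suc n C suc k) p-prime (divides (n C k) (trans (absorption n k) (*-comm (suc n) (n C k))))
...   | inj₁ p∣k = ⊥-elim (p∤k p∣k)
...   | inj₂ p∣C = p∣C

module Frobenius (p : ℕ) .{{_ : NonZero p}} (p-prime : Prime p) where

  open Congruence p

  frobenius : binomial p ≈ dilate p (binomial 1)
  frobenius n with p ∣? n
  ... | yes (divides-refl 0) = cong (_% p) (sym (dilate-* p (binomial 1) 0))
  ... | yes (divides-refl 1) = begin
    (p C (1 * p)) % p                  ≡⟨ cong (λ k → (p C k) % p) (*-identityˡ p) ⟩
    (p C p) % p                        ≡⟨ cong (_% p) (nCn≡1 p) ⟩
    1 % p                              ≡⟨ cong (_% p) (dilate-* p (binomial 1) 1) ⟨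
    dilate p (binomial 1) (1 * p) % p  ∎
  ... | yes (divides-refl j@(suc (suc _))) = cong (_% p) (trans (k>n⇒nCk≡0 p<j*p) (sym (dilate-* p (binomial 1) j)))
    where
    p<j*p : p < j * p
    p<j*p = subst (p <_) (*-comm p j) (m<m*n p j (s≤s (s≤s z≤n)))
  ... | no p∤n = begin
    (p C n) % p                  ≡⟨ n∣m⇒m%n≡0 _ p (prime∣binomial p-prime p∤n) ⟩
    0                            ≡⟨ 0%m≡0 ⟨
    0 % p                        ≡⟨ cong (_% p) (dilate-∤ p (binomial 1) p∤n) ⟨
    dilate p (binomial 1) n % p  ∎

  frobenius-[1+x²] : [1+x²]^ p ≈ dilate p ([1+x²]^ 1)
  frobenius-[1+x²] n = trans (dilate-cong-≈ 2 frobenius n) (cong (_% p) (dilate-comm 2 p (binomial 1) n))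

-- Coefficient lists

at-++ˡ : ∀ (xs ys : List ℕ) {i} → i < length xs → at (xs ++ ys) i ≡ at xs i
at-++ˡ (x ∷ xs) ys {zero}  _         = refl
at-++ˡ (x ∷ xs) ys {suc i} (s≤s i<n) = at-++ˡ xs ys i<n

at-++ʳ : ∀ (xs ys : List ℕ) i → at (xs ++ ys) (length xs + i) ≡ at ys i
at-++ʳ []       ys i = refl
at-++ʳ (x ∷ xs) ys i = at-++ʳ xs ys i

at-applyUpTo : ∀ (f : ℕ → ℕ) n {r} → r < n → at (applyUpTo f n) r ≡ f r
at-applyUpTo f (suc n) {zero}  _         = refl
at-applyUpTo f (suc n) {suc r} (s≤s r<n) = at-applyUpTo (f ∘ suc) n r<n

at-beyond : ∀ (xs : List ℕ) {j} → length xs ≤ j → at xs j ≡ 0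
at-beyond []       _           = refl
at-beyond (x ∷ xs) (s≤s len≤j) = at-beyond xs len≤j

module _ {m : ℕ} where

  all-multiples : ∀ xs → ¬ Any (λ a → ¬ m ∣ a) xs → ∀ j → m ∣ at xs j
  all-multiples []       _      j       = m ∣0
  all-multiples (x ∷ xs) ¬any   zero    = decidable-stable (m ∣? x) (¬any ∘ here)
  all-multiples (x ∷ xs) ¬any   (suc j) = all-multiples xs (¬any ∘ there) j

  last-non-multiple : ∀ xs → Any (λ a → ¬ m ∣ a) xs →
                      ∃ λ j → j < length xs × ¬ m ∣ at xs j × (∀ k → j < k → m ∣ at xs k)
  last-non-multiple (x ∷ xs) any-x∷xs with any? (λ a → ¬? (m ∣? a)) xs
  ... | yes any-xs with last-non-multiple xs any-xs
  ...   | j , j<len , m∤ , above = suc j , s≤s j<len , m∤ , λ { (suc k) (s≤s j<k) → above k j<k }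
  last-non-multiple (x ∷ xs) (here m∤x)    | no ¬any-xs = 0 , s≤s z≤n , m∤x , λ { (suc k) _ → all-multiples xs ¬any-xs k }
  last-non-multiple (x ∷ xs) (there any-xs) | no ¬any-xs = ⊥-elim (¬any-xs any-xs)

m+n<ᵇm≡false : ∀ m n → ((m + n) <ᵇ m) ≡ false
m+n<ᵇm≡false zero    n = refl
m+n<ᵇm≡false (suc m) n = m+n<ᵇm≡false m n

pad-+ : ∀ k (f : Series) i → pad k f (k + i) ≡ f i
pad-+ k f i rewrite m+n<ᵇm≡false k i | m+n∸m≡n k i = refl

pad-vanishes : ∀ k (f : Series) i → f (i ∸ k) ≡ 0 → pad k f i ≡ 0
pad-vanishes k f i f[i∸k]≡0 with i <ᵇ k
... | true  = refl
... | false = f[i∸k]≡0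

-- The p-Cantor word and series

n<m^n : ∀ {m} → 1 < m → ∀ n → n < m ^ n
n<m^n _ zero = s≤s z≤n
n<m^n {m} 1<m@(s≤s (s≤s _)) (suc n) =
  ≤-<-trans (n<m^n 1<m n) (subst (m ^ n <_) (*-comm (m ^ n) m) (m<m*n (m ^ n) m {{m^n≢0 m n}} 1<m))

module CantorWord (p : ℕ) .{{_ : NonZero p}} (1<p : 1 < p) where

  word : ℕ → List ℕ
  word n = iter (φ p) n (1 ∷ [])

  length-φ-letter : ∀ x → length (φ-letter p x) ≡ p
  length-φ-letter x = trans (length-map _ (upTo p)) (length-upTo p)

  length-φ : ∀ w → length (φ p w) ≡ length w * p
  length-φ []      = refl
  length-φ (x ∷ w) = trans (length-++ (φ-letter p x)) (cong₂ _+_ (length-φ-letter x) (length-φ w))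

  φ-++ : ∀ xs ys → φ p (xs ++ ys) ≡ φ p xs ++ φ p ys
  φ-++ xs ys = trans (cong concat (map-++ (φ-letter p) xs ys)) (sym (concat-++ (map (φ-letter p) xs) (map (φ-letter p) ys)))

  at-φ : ∀ w {k r} → k < length w → r < p → at (φ p w) (k * p + r) ≡ φ-letterAt p (at w k) r
  at-φ (x ∷ w) {zero} {r} _ r<p = begin
    at (φ-letter p x ++ φ p w) r      ≡⟨ at-++ˡ (φ-letter p x) (φ p w) (subst (r <_) (sym (length-φ-letter x)) r<p) ⟩
    at (map (φ-letterAt p x) (upTo p)) r ≡⟨ cong (λ l → at l r) (map-applyUpTo id (φ-letterAt p x) p) ⟩
    at (applyUpTo (φ-letterAt p x) p) r  ≡⟨ at-applyUpTo (φ-letterAt p x) p r<p ⟩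
    φ-letterAt p x r                  ∎
  at-φ (x ∷ w) {suc k} {r} (s≤s k<n) r<p = begin
    at (φ-letter p x ++ φ p w) (p + k * p + r)
      ≡⟨ cong (at (φ-letter p x ++ φ p w)) (+-assoc p (k * p) r) ⟩
    at (φ-letter p x ++ φ p w) (p + (k * p + r))
      ≡⟨ cong (λ n → at (φ-letter p x ++ φ p w) (n + (k * p + r))) (length-φ-letter x) ⟨
    at (φ-letter p x ++ φ p w) (length (φ-letter p x) + (k * p + r))
      ≡⟨ at-++ʳ (φ-letter p x) (φ p w) (k * p + r) ⟩
    at (φ p w) (k * p + r)
      ≡⟨ at-φ w k<n r<p ⟩
    φ-letterAt p (at w k) r ∎

  first-letter : φ-letterAt p 1 0 ≡ 1
  first-letter = m<n⇒m%n≡m 1<p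

  word-extends : ∀ n → ∃ λ rest → word (suc n) ≡ word n ++ rest
  word-extends zero    = _ , trans (cong (λ m → map (φ-letterAt p 1) (upTo m) ++ []) (sym (suc-pred p)))
                                   (cong (_∷ map (φ-letterAt p 1) (applyUpTo suc (pred p)) ++ []) first-letter)
  word-extends (suc n) with word-extends n
  ... | rest , word[1+n]≡ = φ p rest , trans (cong (φ p) word[1+n]≡) (φ-++ (word n) rest)

  length-word : ∀ n → length (word n) ≡ p ^ n
  length-word zero    = refl
  length-word (suc n) = trans (length-φ (word n)) (trans (cong (_* p) (length-word n)) (*-comm (p ^ n) p))

  <p^n⇒<length-word : ∀ n {i} → i < p ^ n → i < length (word n)
  <p^n⇒<length-word n = subst (_ <_) (sym (length-word n))

  at-word-+ : ∀ d n {i} → i < length (word n) → at (word (d + n)) i ≡ at (word n) i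
  at-word-+ zero    n _ = refl
  at-word-+ (suc d) n {i} i<len with word-extends (d + n)
  ... | rest , word≡ = trans (cong (λ w → at w i) word≡) (trans (at-++ˡ (word (d + n)) rest i<len′) (at-word-+ d n i<len))
    where
    i<len′ : i < length (word (d + n))
    i<len′ = <p^n⇒<length-word (d + n) (<-≤-trans (subst (i <_) (length-word n) i<len) (^-monoʳ-≤ p (m≤n+m n d)))

  at-word : ∀ n {i} → i < length (word n) → at (word n) i ≡ cantor p i
  at-word n {i} i<len with ≤-total n (suc i)
  ... | inj₁ n≤1+i = trans (sym (at-word-+ (suc i ∸ n) n i<len)) (cong (λ m → at (word m) i) (m∸n+n≡m n≤1+i))
  ... | inj₂ 1+i≤n = trans (cong (λ m → at (word m) i) (sym (m∸n+n≡m 1+i≤n)))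
                           (at-word-+ (n ∸ suc i) (suc i) (<p^n⇒<length-word (suc i) (<-trans (n<1+n i) (n<m^n 1<p (suc i)))))

  cantor-0 : cantor p 0 ≡ 1
  cantor-0 = sym (at-word 0 (s≤s z≤n))

  cantor-digit : ∀ k {r} → r < p → cantor p (r + k * p) ≡ φ-letterAt p (cantor p k) r
  cantor-digit k {r} r<p = begin
    at (φ p (word N)) (r + k * p)    ≡⟨ cong (at (φ p (word N))) (+-comm r (k * p)) ⟩
    at (φ p (word N)) (k * p + r)    ≡⟨ at-φ (word N) k<len r<p ⟩
    φ-letterAt p (at (word N) k) r   ≡⟨ cong (λ c → φ-letterAt p c r) (at-word N k<len) ⟩
    φ-letterAt p (cantor p k) r      ∎
    where
    N = r + k * p
    k<len : k < length (word N)
    k<len = <p^n⇒<length-word N (≤-<-trans (≤-trans (m≤m*n k p) (m≤n+m (k * p) r)) (n<m^n 1<p N))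

module CantorSeries (p : ℕ) .{{_ : NonZero p}} (p-prime : Prime p) (p≡1+p₂*2 : p ≡ suc (p₂ p * 2)) where

  open Congruence p
  open Frobenius p p-prime

  1<p : 1 < p
  1<p = nonTrivial⇒n>1 p {{prime⇒nonTrivial p-prime}}

  open CantorWord p 1<p

  E : Series
  E = [1+x²]^ (p₂ p)

  φ-letterAt≡ : ∀ x r → φ-letterAt p x r ≡ (x * E r) % p
  φ-letterAt≡ x r with r % 2
  ... | zero  = refl
  ... | suc _ = sym (trans (cong (_% p) (*-zeroʳ x)) 0%m≡0)

  E-vanishes : ∀ r → p ≤ r → E r ≡ 0
  E-vanishes r p≤r with 2 ∣? r
  ... | no 2∤r = dilate-∤ 2 (binomial (p₂ p)) 2∤r
  ... | yes (divides-refl j) = trans (dilate-* 2 (binomial (p₂ p)) j) (k>n⇒nCk≡0 p₂<j)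
    where
    p₂<j : p₂ p < j
    p₂<j = *-cancelʳ-< 2 (p₂ p) j (subst (_≤ j * 2) p≡1+p₂*2 p≤r)

  cantor≈E⋆dilate : cantor p ≈ E ⋆ dilate p (cantor p)
  cantor≈E⋆dilate n = subst (λ i → cantor p i % p ≡ (E ⋆ dilate p (cantor p)) i % p)
                            (sym (m≡m%n+[m/n]*n n p)) (digit (n / p) (m%n<n n p))
    where
    digit : ∀ k {r} → r < p → cantor p (r + k * p) % p ≡ (E ⋆ dilate p (cantor p)) (r + k * p) % p
    digit k {r} r<p = begin
      cantor p (r + k * p) % p                ≡⟨ cong (_% p) (cantor-digit k r<p) ⟩
      φ-letterAt p (cantor p k) r % p         ≡⟨ cong (_% p) (φ-letterAt≡ (cantor p k) r) ⟩
      (cantor p k * E r) % p % p              ≡⟨ m%n%n≡m%n (cantor p k * E r) p ⟩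
      (cantor p k * E r) % p                  ≡⟨ cong (_% p) (*-comm (cantor p k) (E r)) ⟩
      (E r * cantor p k) % p                  ≡⟨ cong (_% p) (⋆-dilate-digit p E (cantor p) E-vanishes k r<p) ⟨
      (E ⋆ dilate p (cantor p)) (r + k * p) % p ∎

  [1+x²]⋆E⋆E≈ : [1+x²]^ 1 ⋆ (E ⋆ E) ≈ dilate p ([1+x²]^ 1)
  [1+x²]⋆E⋆E≈ n = begin
    ([1+x²]^ 1 ⋆ (E ⋆ E)) n % p             ≡⟨ cong (_% p) (⋆-congˡ ([1+x²]^ 1) ([1+x²]^-+ (p₂ p) (p₂ p)) n) ⟩
    ([1+x²]^ 1 ⋆ [1+x²]^ (p₂ p + p₂ p)) n % p ≡⟨ cong (_% p) ([1+x²]^-+ 1 (p₂ p + p₂ p) n) ⟩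
    ([1+x²]^ (1 + (p₂ p + p₂ p))) n % p      ≡⟨ cong (λ m → ([1+x²]^ m) n % p) 1+p₂+p₂≡p ⟩
    ([1+x²]^ p) n % p                       ≡⟨ frobenius-[1+x²] n ⟩
    dilate p ([1+x²]^ 1) n % p              ∎
    where
    1+p₂+p₂≡p : 1 + (p₂ p + p₂ p) ≡ p
    1+p₂+p₂≡p = trans (cong (λ m → suc (p₂ p + m)) (sym (+-identityʳ (p₂ p))))
                      (trans (cong suc (*-comm 2 (p₂ p))) (sym p≡1+p₂*2))

  G : Series
  G = [1+x²]^ 1 ⋆ (cantor p ⋆ cantor p)

  G≈dilate : G ≈ dilate p G
  G≈dilate n = begin
    G n % p
      ≡⟨ ⋆-cong-≈ {[1+x²]^ 1} (λ _ → refl) (⋆-cong-≈ cantor≈E⋆dilate cantor≈E⋆dilate) n ⟩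
    ([1+x²]^ 1 ⋆ ((E ⋆ σc) ⋆ (E ⋆ σc))) n % p
      ≡⟨ cong (_% p) (⋆-congˡ ([1+x²]^ 1) (⋆-interchange E σc E σc) n) ⟩
    ([1+x²]^ 1 ⋆ ((E ⋆ E) ⋆ (σc ⋆ σc))) n % p
      ≡⟨ cong (_% p) (⋆-assoc ([1+x²]^ 1) (E ⋆ E) (σc ⋆ σc) n) ⟨
    (([1+x²]^ 1 ⋆ (E ⋆ E)) ⋆ (σc ⋆ σc)) n % p
      ≡⟨ ⋆-cong-≈ {g = σc ⋆ σc} [1+x²]⋆E⋆E≈ (λ _ → refl) n ⟩
    (dilate p ([1+x²]^ 1) ⋆ (σc ⋆ σc)) n % p
      ≡⟨ cong (_% p) (⋆-congˡ (dilate p ([1+x²]^ 1)) (dilate-⋆ p (cantor p) (cantor p)) n) ⟩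
    (dilate p ([1+x²]^ 1) ⋆ dilate p (cantor p ⋆ cantor p)) n % p
      ≡⟨ cong (_% p) (dilate-⋆ p ([1+x²]^ 1) (cantor p ⋆ cantor p) n) ⟩
    dilate p G n % p ∎
    where
    σc = dilate p (cantor p)

  G-constant : ∀ n → 0 < n → G n % p ≡ 0
  G-constant = dilate-invariant⇒constant p 1<p G G≈dilate

  cantor-before-power : ∀ k {n} → suc n ≡ p ^ k → cantor p n ≡ 1
  cantor-before-power zero    refl = cantor-0
  cantor-before-power (suc k) {n} 1+n≡p^[1+k] = begin
    cantor p n                                ≡⟨ cong (cantor p) n≡digits ⟩
    cantor p (p₂ p * 2 + m * p)               ≡⟨ cantor-digit m p₂*2<p ⟩
    φ-letterAt p (cantor p m) (p₂ p * 2)      ≡⟨ φ-letterAt≡ (cantor p m) (p₂ p * 2) ⟩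
    (cantor p m * E (p₂ p * 2)) % p           ≡⟨ cong₂ (λ a b → (a * b) % p) (cantor-before-power k 1+m≡p^k) E[p₂*2]≡1 ⟩
    1 % p                                     ≡⟨ m<n⇒m%n≡m 1<p ⟩
    1                                         ∎
    where
    m = pred (p ^ k)
    1+m≡p^k : suc m ≡ p ^ k
    1+m≡p^k = suc-pred (p ^ k) {{m^n≢0 p k}}
    p₂*2<p : p₂ p * 2 < p
    p₂*2<p = subst (p₂ p * 2 <_) (sym p≡1+p₂*2) ≤-refl
    E[p₂*2]≡1 : E (p₂ p * 2) ≡ 1
    E[p₂*2]≡1 = trans (dilate-* 2 (binomial (p₂ p)) (p₂ p)) (nCn≡1 (p₂ p))
    n≡digits : n ≡ p₂ p * 2 + m * p
    n≡digits = suc-injective (begin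
      suc n                      ≡⟨ 1+n≡p^[1+k] ⟩
      p * p ^ k                  ≡⟨ cong (p *_) 1+m≡p^k ⟨
      p * suc m                  ≡⟨ *-suc p m ⟩
      p + p * m                  ≡⟨ cong₂ _+_ p≡1+p₂*2 (*-comm p m) ⟩
      suc (p₂ p * 2) + m * p     ∎)

  cantor-after-power : ∀ k {n} → p ^ k ≤ n → n < p ^ k + p ^ k → cantor p n ≡ 0
  cantor-after-power zero    (s≤s z≤n) (s≤s (s≤s z≤n)) = cantor-digit 0 1<p
  cantor-after-power (suc k) {n} p^[1+k]≤n n<2p^[1+k] = begin
    cantor p n                                        ≡⟨ cong (cantor p) (m≡m%n+[m/n]*n n p) ⟩
    cantor p (n % p + (n / p) * p)                    ≡⟨ cantor-digit (n / p) (m%n<n n p) ⟩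
    φ-letterAt p (cantor p (n / p)) (n % p)           ≡⟨ φ-letterAt≡ (cantor p (n / p)) (n % p) ⟩
    (cantor p (n / p) * E (n % p)) % p                ≡⟨ cong (λ c → (c * E (n % p)) % p) (cantor-after-power k lower upper) ⟩
    0 % p                                             ≡⟨ 0%m≡0 ⟩
    0                                                 ∎
    where
    lower : p ^ k ≤ n / p
    lower = subst (_≤ n / p) (m*n/n≡m (p ^ k) p) (/-monoˡ-≤ p (subst (_≤ n) (*-comm p (p ^ k)) p^[1+k]≤n))
    upper : n / p < p ^ k + p ^ k
    upper = m<n*o⇒m/o<n (subst (n <_) (trans (sym (*-distribˡ-+ p (p ^ k) (p ^ k))) (*-comm p _)) n<2p^[1+k])

  G-0 : G 0 ≡ 1
  G-0 rewrite cantor-0 = refl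

  θ : Series
  θ = coeff (Θ p)

  θ≗ : θ ≗ timesX (cantor p)
  θ≗ zero    = refl
  θ≗ (suc n) = refl

  θ-power : ∀ k → θ (p ^ k) ≡ 1
  θ-power k = subst (λ i → θ i ≡ 1) 1+m≡p^k (cantor-before-power k 1+m≡p^k)
    where
    1+m≡p^k : suc (pred (p ^ k)) ≡ p ^ k
    1+m≡p^k = suc-pred (p ^ k) {{m^n≢0 p k}}

  θ-gap : ∀ k {i} → p ^ k < i → i ≤ p ^ k + p ^ k → θ i ≡ 0
  θ-gap k {suc i} (s≤s p^k≤i) i<2p^k = cantor-after-power k p^k≤i i<2p^k

  -- Compare the coefficients of index L + M in Q Θ = P: on the right it lies beyond deg P, on the
  -- left the zeros of θ after θ (p ^ LQ) = 1 leave only the last coefficient of Q not divisible by p.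
  Θ-irrational : ¬ IsRational p (Θ p)
  Θ-irrational (P , Q , Q≢0 , QΘ≈P) with last-non-multiple (0 ∷ reverse Q) (there (reverse⁺ Q≢0))
  ... | j₀ , j₀<len , p∤ , above = p∤ (m%n≡0⇒n∣m _ p (begin
    ql j₀ % p                                       ≡⟨ ⋆-last-term ql θ j₀ (p ^ LQ) above (θ-power LQ) gap ⟨
    (ql ⋆ θ) M % p                                  ≡⟨ cong (_% p) (pad-+ L (ql ⋆ θ) M) ⟨
    pad L (ql ⋆ θ) (L + M) % p                      ≡⟨ QΘ≈P (L + M) ⟩
    pad (LQ + 0) (at (0 ∷ reverse P)) (L + M) % p   ≡⟨ cong (_% p) (pad-vanishes (LQ + 0) (at (0 ∷ reverse P)) (L + M) (at-beyond (0 ∷ reverse P) beyond)) ⟩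
    0 % p                                           ≡⟨ 0%m≡0 ⟩
    0                                               ∎))
    where
    ql = at (0 ∷ reverse Q)
    L  = length P
    LQ = length Q
    M  = p ^ LQ + j₀
    LQ<p^LQ : LQ < p ^ LQ
    LQ<p^LQ = n<m^n 1<p LQ
    j₀≤p^LQ : j₀ ≤ p ^ LQ
    j₀≤p^LQ = ≤-trans (≤-pred (subst (j₀ <_) (cong suc (length-reverse Q)) j₀<len)) (<⇒≤ LQ<p^LQ)
    gap : ∀ i → p ^ LQ < i → i ≤ p ^ LQ + j₀ → θ i ≡ 0
    gap i p^LQ<i i≤ = θ-gap LQ p^LQ<i (≤-trans i≤ (+-monoʳ-≤ (p ^ LQ) j₀≤p^LQ))
    beyond : length (0 ∷ reverse P) ≤ L + M ∸ (LQ + 0)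
    beyond = subst (_≤ L + M ∸ (LQ + 0)) (cong suc (sym (length-reverse P)))
      (m+n≤o⇒m≤o∸n (suc L) (subst (_≤ L + M) (+-suc L (LQ + 0))
        (+-monoʳ-≤ L (≤-trans (subst (_< p ^ LQ) (sym (+-identityʳ LQ)) LQ<p^LQ) (m≤m+n (p ^ LQ) j₀)))))

  x⁴[G+p-1]≡0 : ∀ i → (timesX (timesX (timesX (timesX G))) i + pad 3 (at (0 ∷ p ∸ 1 ∷ [])) i) % p ≡ 0
  x⁴[G+p-1]≡0 0 = 0%m≡0
  x⁴[G+p-1]≡0 1 = 0%m≡0
  x⁴[G+p-1]≡0 2 = 0%m≡0
  x⁴[G+p-1]≡0 3 = 0%m≡0
  x⁴[G+p-1]≡0 4 = begin
    (G 0 + (p ∸ 1)) % p   ≡⟨ cong (λ g → (g + (p ∸ 1)) % p) G-0 ⟩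
    (1 + (p ∸ 1)) % p     ≡⟨ cong (_% p) (m+[n∸m]≡n (<⇒≤ 1<p)) ⟩
    p % p                 ≡⟨ n%n≡0 p ⟩
    0                     ∎
  x⁴[G+p-1]≡0 (suc (suc (suc (suc (suc k))))) =
    trans (cong (_% p) (+-identityʳ (G (suc k)))) (G-constant (suc k) z<s)

  -- poly (1 ∷ 0 ∷ 1 ∷ []) is stored as t³ (x + x³).
  [x+x³]⋆θ⋆θ≗x³G : at (0 ∷ 1 ∷ 0 ∷ 1 ∷ []) ⋆ θ ⋆ θ ≗ timesX (timesX (timesX G))
  [x+x³]⋆θ⋆θ≗x³G n = begin
    (at (0 ∷ 1 ∷ 0 ∷ 1 ∷ []) ⋆ θ ⋆ θ) n         ≡⟨ ⋆-cong (⋆-cong x+x³≗x[1+x²] θ≗) θ≗ n ⟩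
    (timesX D ⋆ timesX c ⋆ timesX c) n         ≡⟨ ⋆-congʳ (timesX c) (⋆-timesX D c) n ⟩
    (timesX (timesX (D ⋆ c)) ⋆ timesX c) n     ≡⟨ ⋆-timesX (timesX (D ⋆ c)) c n ⟩
    timesX (timesX (timesX (D ⋆ c) ⋆ c)) n     ≡⟨ timesX-cong (timesX-cong (⋆-timesXˡ (D ⋆ c) c)) n ⟩
    timesX (timesX (timesX (D ⋆ c ⋆ c))) n     ≡⟨ timesX-cong (timesX-cong (timesX-cong (⋆-assoc D c c))) n ⟩
    timesX (timesX (timesX G)) n               ∎
    where
    D = [1+x²]^ 1
    c = cantor p
    x+x³≗x[1+x²] : at (0 ∷ 1 ∷ 0 ∷ 1 ∷ []) ≗ timesX D
    x+x³≗x[1+x²] zero    = refl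
    x+x³≗x[1+x²] (suc n) = sym ([1+x²]^1≗ n)

  -- (1 + t²) Θ² − 1 = 0, with −1 written as p − 1.
  Θ-quadratic : IsQuadraticRoot p (Θ p)
  Θ-quadratic = (1 ∷ 0 ∷ 1 ∷ []) , [] , (p ∸ 1 ∷ []) , here p∤1 , [1+t²]Θ²-1≈0
    where
    p∤1 : ¬ p ∣ 1
    p∤1 p∣1 = <⇒≢ 1<p (sym (∣1⇒≡1 p∣1))
    0⋆θ≡0 : ∀ n → (at (0 ∷ []) ⋆ θ) n ≡ 0
    0⋆θ≡0 n = sumTo-zero n (λ i → at (0 ∷ []) i * θ (n ∸ i)) λ { zero _ → refl ; (suc _) _ → refl }
    [1+t²]Θ²-1≈0 : _≈ₚ_ p (poly (1 ∷ 0 ∷ 1 ∷ []) ⊗ Θ p ⊗ Θ p ⊕ poly [] ⊗ Θ p ⊕ poly (p ∸ 1 ∷ [])) zeroLS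
    [1+t²]Θ²-1≈0 zero    = refl
    [1+t²]Θ²-1≈0 (suc j) = begin
      ((at (0 ∷ 1 ∷ 0 ∷ 1 ∷ []) ⋆ θ ⋆ θ) j + pad 3 (at (0 ∷ []) ⋆ θ) j + C (suc j)) % p
        ≡⟨ cong (λ x → (x + C (suc j)) % p) (cong₂ _+_ ([x+x³]⋆θ⋆θ≗x³G j) (pad-vanishes 3 (at (0 ∷ []) ⋆ θ) j (0⋆θ≡0 (j ∸ 3)))) ⟩
      (timesX (timesX (timesX G)) j + 0 + C (suc j)) % p
        ≡⟨ cong (λ x → (x + C (suc j)) % p) (+-identityʳ _) ⟩
      (timesX (timesX (timesX G)) j + C (suc j)) % p
        ≡⟨ x⁴[G+p-1]≡0 (suc j) ⟩
      0
        ≡⟨ 0%m≡0 ⟨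
      0 % p
        ≡⟨ cong (_% p) (pad-vanishes 4 (λ _ → 0) (suc j) refl) ⟨
      pad 4 (λ _ → 0) (suc j) % p ∎
      where
      C = pad 3 (at (0 ∷ p ∸ 1 ∷ []))

odd-prime⇒≡1+p₂*2 : ∀ p .{{_ : NonZero p}} → Prime p → p ≢ 2 → p ≡ suc (p₂ p * 2)
odd-prime⇒≡1+p₂*2 p p-prime p≢2 with p % 2 in p%2≡r | m%n<n p 2
... | 0 | _ = ⊥-elim (2∤p (m%n≡0⇒n∣m p 2 p%2≡r))
  where
  2∤p : ¬ 2 ∣ p
  2∤p 2∣p with prime⇒irreducible p-prime 2∣p
  ... | inj₁ ()
  ... | inj₂ 2≡p = p≢2 (sym 2≡p)
... | 1 | _ = trans p≡1+[p/2]*2 (cong (λ h → suc (h * 2)) (sym p₂≡p/2))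
  where
  p≡1+[p/2]*2 : p ≡ suc (p / 2 * 2)
  p≡1+[p/2]*2 = trans (m≡m%n+[m/n]*n p 2) (cong (_+ p / 2 * 2) p%2≡r)
  p₂≡p/2 : p₂ p ≡ p / 2
  p₂≡p/2 = trans (cong (λ n → (n ∸ 1) / 2) p≡1+[p/2]*2) (m*n/n≡m (p / 2) 2)
... | suc (suc _) | s≤s (s≤s ())

mainTheorem10 : (p : ℕ) .{{_ : NonZero p}} → Prime p → p ≢ 2 →
    IsQuadraticIrrational p (Θ p)
mainTheorem10 p p-prime p≢2 = Θ-irrational , Θ-quadratic
  where open CantorSeries p p-prime (odd-prime⇒≡1+p₂*2 p p-prime p≢2)
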